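{- Let $H=(Q^0,Q^1,\delta^0,\delta^1,q_0)$ be a two-player game graph, $Q=Q^0\cup Q^1$, and let $F_{\mathcal A},F_{\mathcal G}\subseteq Q$, $\mathcal F_{\mathcal A}=\{F_{\mathcal A}\}$, $\mathcal F_{\mathcal G}=\{F_{\mathcal G}\}$. Let $Z^\infty=[\![\varphi_4]\!]$ where $$\varphi_4=\nu Z.\,\mu Y.\,\nu X.\,\mu W.\;\big(F_{\mathcal G}\cap \mathrm{Pre}^1(Z)\big)\cup \mathrm{Pre}^1(Y)\cup\big((Q\setminus F_{\mathcal A})\cap \mathrm{CPre}(W,\,X\setminus F_{\mathcal A})\big),$$ and let $\mathrm{rank}:Z^\infty\to\mathbb N^2$ be the ranking defined below. Let $f^1$ be a memoryless system strategy such that for every $q\in Q^1\cap Z^\infty$, $q'=f^1(q)$ satisfies $q'\in\delta^1(q)$ and: $q'\in Z^\infty$ with $\mathrm{rank}(q')<\mathrm{rank}(q)$ if $\mathrm{rank}(q)>(1,1)$, and $q'\in Z^\infty$ otherwise. Then for all $q\in Z^\infty$: (a) $\mathcal L_q(H,f^1)\subseteq \overline{\mathcal L_q(H,\mathcal F_{\mathcal A})}\cup \mathcal L_q(H,\mathcal F_{\mathcal G})$; (b) $\mathcal L_q(H,f^1)\cap\mathcal L_q(H,\mathcal F_{\mathcal G})\neq\emptyset$; (c) if $\mathcal L_q(H,\mathcal F_{\mathcal G})\subseteq\mathcal L_q(H,\mathcal F_{\mathcal A})$, then $\mathrm{pre}(\mathcal L_q(H,f^1))=\mathrm{pre}\big(\mathcal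 L_q(H,f^1)\cap \mathcal L_q(H,\mathcal F_{\mathcal A})\big)$.
   Context: A two-player game graph $H=(Q^0,Q^1,\delta^0,\delta^1,q_0)$ has finite disjoint state sets $Q^0$ (environment, player 0) and $Q^1$ (system, player 1), transition functions $\delta^0:Q^0\to 2^{Q^1}$, $\delta^1:Q^1\to 2^{Q^0}$, and $q_0\in Q^0$. For $q\in Q$, a play from $q$ is an infinite state sequence $\pi$ with $\pi(0)=q$ and $\pi(k+1)\in\delta^0(\pi(k))$ if $\pi(k)\in Q^0$, $\pi(k+1)\in\delta^1(\pi(k))$ if $\pi(k)\in Q^1$. A system strategy maps finite play prefixes ending in $Q^1$ to states in $Q^0$; it is memoryless if it depends only on the last state. $\mathcal L_q(H,f^1)$ is the set of plays from $q$ in which every move from a $Q^1$-state is the one given by $f^1$. For a family $\mathcal F$ of subsets of $Q$, $\mathcal L_q(H,\mathcal F)$ is the set of plays from $q$ visiting every set in $\mathcal F$ infinitely often; $\overline{\mathcal L}$ denotes complement within the set of all infinite state sequences, and $\mathrm{pre}(\mathcal L)$ is the set of all finite prefixes of words in $\mathcal L$. For $P,P'\subseteq Q$: $\mathrm{Pre}^{\exists}(P)=\{q\in Q^0:\delta^0(q)\cap P\neq\emptyset\}\cup\{q\in Q^1:\delta^1(q)\cap P\neq\emptyset\}$; $\mathrm{Pre}^1(P)=\{q\in Q^0:\delta^0(q)\subseteq P\}\cup\{q\in Q^1:\delta^1(q)\cap P\neq\emptyset\}$; $\mathrm{CPre}(P,P')=\mathrm{Pre}^{\exists}(P)\cap\mathrm{Pre}^1(P\cup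 P')$. $\mu,\nu$ denote least and greatest fixpoints (modal $\mu$-calculus over subsets of $Q$). Ranking: let $\Phi(Y,X,W)=(F_{\mathcal G}\cap\mathrm{Pre}^1(Z^\infty))\cup\mathrm{Pre}^1(Y)\cup((Q\setminus F_{\mathcal A})\cap\mathrm{CPre}(W,X\setminus F_{\mathcal A}))$ (the body with $Z:=Z^\infty$). Set $Y^0=\emptyset$ and for $i\ge1$, $Y^i=\nu X.\mu W.\Phi(Y^{i-1},X,W)$ (so $Y^i$ is the $i$-th iterate of $\mu Y$ in the last iteration of $Z$, and $Y^k=Z^\infty$ for some $k$). For $i\ge1$ let $W^i_0=\emptyset$ and $W^i_j=\Phi(Y^{i-1},Y^i,W^i_{j-1})$ for $j\ge1$. For $q\in Z^\infty$ and $i,j>0$, $\mathrm{rank}(q)=(i,j)$ iff $q\in(Y^i\setminus Y^{i-1})\cap(W^i_j\setminus W^i_{j-1})$. Ranks are ordered lexicographically. -}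

module Defs where

open import Data.Nat using (ℕ; zero; suc; _+_; _≤_; _<_)
open import Data.Fin using (Fin; toℕ)
open import Data.Bool using (Bool; true; false; _∧_; _∨_; not)
open import Data.Sum using (_⊎_; inj₁; inj₂)
open import Data.Product using (Σ; ∃; ∃-syntax; _×_; _,_)
open import Data.List using (List; length; lookup)
open import Data.Empty using (⊥)
open import Relation.Binary.PropositionalEquality using (_≡_)

anyFin : ∀ m → (Fin m → Bool) → Bool
anyFin zero    p = false
anyFin (suc m) p = p Fin.zero ∨ anyFin m (λ i → p (Fin.suc i))

allFin : ∀ m → (Fin m → Bool) → Bool
allFin zero    p = true
allFin (suc m) p = p Fin.zero ∧ allFin m (λ i → p (Fin.suc i))

-- Q⁰ = Fin n0 (environment), Q¹ = Fin n1 (system),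
-- Q = Q⁰ ⊎ Q¹ (disjoint by construction).  δ⁰ : Q⁰ → 2^{Q¹} and
-- δ¹ : Q¹ → 2^{Q⁰} are given as boolean characteristic functions.

record GameGraph : Set where
  field
    n0 : ℕ
    n1 : ℕ
    δ0 : Fin n0 → Fin n1 → Bool
    δ1 : Fin n1 → Fin n0 → Bool
    q0 : Fin n0

module _ (H : GameGraph) where
  open GameGraph H

  State : Set
  State = Fin n0 ⊎ Fin n1

  Sub : Set
  Sub = State → Bool

  Edge : State → State → Bool
  Edge (inj₁ a) (inj₁ b) = false
  Edge (inj₁ a) (inj₂ b) = δ0 a b
  Edge (inj₂ a) (inj₁ b) = δ1 a b
  Edge (inj₂ a) (inj₂ b) = false

  NonBlocking : Set
  NonBlocking = (q : State) → ∃[ q' ] (Edge q q' ≡ true)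

  ∅ˢ : Sub
  ∅ˢ _ = false

  Qˢ : Sub
  Qˢ _ = true

  _∪ˢ_ : Sub → Sub → Sub
  (P ∪ˢ P') q = P q ∨ P' q

  _∩ˢ_ : Sub → Sub → Sub
  (P ∩ˢ P') q = P q ∧ P' q

  ∁ˢ : Sub → Sub
  ∁ˢ P q = not (P q)

  Pre∃ : Sub → Sub
  Pre∃ P (inj₁ a) = anyFin n1 (λ b → δ0 a b ∧ P (inj₂ b))
  Pre∃ P (inj₂ a) = anyFin n0 (λ b → δ1 a b ∧ P (inj₁ b))

  Pre1 : Sub → Sub
  Pre1 P (inj₁ a) = allFin n1 (λ b → not (δ0 a b) ∨ P (inj₂ b))
  Pre1 P (inj₂ a) = anyFin n0 (λ b → δ1 a b ∧ P (inj₁ b))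

  CPre : Sub → Sub → Sub
  CPre P P' = Pre∃ P ∩ˢ Pre1 (P ∪ˢ P')

  iter : ℕ → (Sub → Sub) → Sub → Sub
  iter zero    f S = S
  iter (suc k) f S = f (iter k f S)

  card : ℕ
  card = n0 + n1

  -- least / greatest fixpoints of a monotone operator on 2^Q, computed by
  -- Kleene iteration from ∅ resp. Q; |Q| iterations suffice since 2^Q has
  -- height |Q| (all operators used below are monotone).
  μ : (Sub → Sub) → Sub
  μ f = iter card f ∅ˢ

  ν : (Sub → Sub) → Sub
  ν f = iter card f Qˢ

  IsPlay : State → (ℕ → State) → Set
  IsPlay q π = (π 0 ≡ q) × ((k : ℕ) → Edge (π k) (π (suc k)) ≡ true)

  MemorylessStrategy : Set
  MemorylessStrategy = Fin n1 → Fin n0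

  Compliant : MemorylessStrategy → (ℕ → State) → Set
  Compliant f π = (k : ℕ) (s : Fin n1) → π k ≡ inj₂ s → π (suc k) ≡ inj₁ (f s)

  Lstrat : State → MemorylessStrategy → (ℕ → State) → Set
  Lstrat q f π = IsPlay q π × Compliant f π

  InfOften : Sub → (ℕ → State) → Set
  InfOften F π = (k : ℕ) → ∃[ m ] (k ≤ m × F (π m) ≡ true)

  Lbuchi : State → Sub → (ℕ → State) → Set
  Lbuchi q F π = IsPlay q π × InfOften F π

  IsPrefix : List State → (ℕ → State) → Set
  IsPrefix w π = (i : Fin (length w)) → lookup w i ≡ π (toℕ i)

  pre : ((ℕ → State) → Set) → List State → Set
  pre L w = ∃[ π ] (L π × IsPrefix w π)

module Fix (H : GameGraph) (FA FG : Sub H) where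

  body : Sub H → Sub H → Sub H → Sub H → Sub H
  body Z Y X W =
    _∪ˢ_ H (_∪ˢ_ H (_∩ˢ_ H FG (Pre1 H Z)) (Pre1 H Y))
           (_∩ˢ_ H (∁ˢ H FA) (CPre H W (_∩ˢ_ H X (∁ˢ H FA))))

  Zinf : Sub H
  Zinf = ν H (λ Z → μ H (λ Y → ν H (λ X → μ H (λ W → body Z Y X W))))

  Φ : Sub H → Sub H → Sub H → Sub H
  Φ Y X W = body Zinf Y X W

  Yit : ℕ → Sub H
  Yit zero    = ∅ˢ H
  Yit (suc i) = ν H (λ X → μ H (λ W → Φ (Yit i) X W))

  -- W^i_j  (only meaningful for i ≥ 1)
  Wit : ℕ → ℕ → Sub H
  Wit i       zero    = ∅ˢ H
  Wit zero    (suc j) = ∅ˢ H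
  Wit (suc i) (suc j) = Φ (Yit i) (Yit (suc i)) (Wit (suc i) j)

  Rank : State H → ℕ → ℕ → Set
  Rank q zero    j       = ⊥
  Rank q (suc i) zero    = ⊥
  Rank q (suc i) (suc j) =
    (Zinf q ≡ true) ×
    (Yit (suc i) q ≡ true) × (Yit i q ≡ false) ×
    (Wit (suc i) (suc j) q ≡ true) × (Wit (suc i) j q ≡ false)

_<lex_ : ℕ × ℕ → ℕ × ℕ → Set
(i , j) <lex (i' , j') = (i < i') ⊎ ((i ≡ i') × (j < j'))

{-# OPTIONS --safe #-}
-- Kleene iteration on the finite lattice 2^Q stabilises within |Q| steps, since a strictly
-- monotone chain of subsets of Q has length at most |Q|; hence the iterates computing φ₄ are
-- genuine fixpoints, and every state of Z∞ gets a unique rank (i , j) from its first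
-- appearance in Y^i and W^i_j.
-- (a) Along a compliant play outside F_G the level (the least i with the state in Y^i) never
-- increases, and it strictly drops when leaving F_A (a system state in F_A ∖ F_G has rank
-- (i , 1)), so infinitely many F_A visits force a visit to F_G after any time.
-- (b) The shape of φ₄ lets the environment also decrease the rank outside F_G, so by
-- well-foundedness of the lexicographic order F_G is visited again and again.
-- (c) A compliant prefix from Z∞ stays in Z∞ and can be continued by the play of (b), which
-- visits F_A infinitely often by hypothesis.
module Submission where

open import Data.Bool using (Bool; true; false; _∧_; _∨_; not)
open import Data.Empty using (⊥; ⊥-elim)
open import Data.Fin using (Fin; splitAt; join)
open import Data.Fin.Properties using (splitAt-join; toℕ<n)
open import Data.Fin.Subset using (Subset; ∣_∣; _∈_)
open import Data.Fin.Subset.Properties using (∣p∣≤n; p⊂q⇒∣p∣<∣q∣)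
open import Data.List using (List; length)
open import Data.Nat
  using (ℕ; zero; suc; _+_; _≤_; _<_; _≤′_; ≤′-refl; ≤′-step; z≤n; s≤s; s≤s⁻¹; _≤?_)
open import Data.Nat.Induction using (<-wellFounded)
open import Data.Nat.Properties
  using (≤-refl; ≤-trans; ≤-<-trans; <⇒≤; <⇒≱; ≰⇒>; <-irrefl; ≤-antisym; ≤⇒≤′; ≤′⇒≤
        ; m≤m+n; m≤n+m; m<n⇒m<1+n; m<1+n⇒m<n∨m≡n; n<1⇒n≡0)
open import Data.Product using (_×_; _,_; proj₁; proj₂; ∃-syntax)
open import Data.Product.Relation.Binary.Lex.Strict using (×-wellFounded)
open import Data.Sum using (_⊎_; inj₁; inj₂; [_,_]′; map₂)
open import Data.Vec using (tabulate)
open import Data.Vec.Properties using (lookup∘tabulate; lookup⇒[]=; []=⇒lookup)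
open import Function using (_∘_; id)
open import Function.Bundles using (_⇔_; mk⇔)
open import Induction.WellFounded using (WellFounded; Acc; acc)
open import Relation.Binary.PropositionalEquality using (_≡_; refl; sym; trans; subst; cong)
open import Relation.Nullary using (yes; no)

open import Defs

infix 4 _⇒ᵇ_

_⇒ᵇ_ : Bool → Bool → Set
a ⇒ᵇ b = a ≡ true → b ≡ true

true≢false : ∀ {a} → a ≡ true → a ≡ false → ⊥
true≢false refl ()

∨-true⁻ : ∀ {a b} → a ∨ b ≡ true → a ≡ true ⊎ b ≡ true
∨-true⁻ {true}  _ = inj₁ refl
∨-true⁻ {false} p = inj₂ p

∨-trueˡ : ∀ {a} b → a ≡ true → a ∨ b ≡ true
∨-trueˡ b refl = refl

∨-trueʳ : ∀ a {b} → b ≡ true → a ∨ b ≡ true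
∨-trueʳ true  _ = refl
∨-trueʳ false p = p

∧-true⁻ : ∀ {a b} → a ∧ b ≡ true → a ≡ true × b ≡ true
∧-true⁻ {true} p = refl , p

∧-true⁺ : ∀ {a b} → a ≡ true → b ≡ true → a ∧ b ≡ true
∧-true⁺ refl p = p

not-true⁻ : ∀ {a} → not a ≡ true → a ≡ false
not-true⁻ {false} _ = refl

∨-mono : ∀ {a a' b b'} → a ⇒ᵇ a' → b ⇒ᵇ b' → a ∨ b ⇒ᵇ a' ∨ b'
∨-mono f g p = [ ∨-trueˡ _ ∘ f , ∨-trueʳ _ ∘ g ]′ (∨-true⁻ p)

∧-mono : ∀ {a a' b b'} → a ⇒ᵇ a' → b ⇒ᵇ b' → a ∧ b ⇒ᵇ a' ∧ b'
∧-mono f g p = let (x , y) = ∧-true⁻ p in ∧-true⁺ (f x) (g y)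

not-antitone : ∀ {a b} → a ⇒ᵇ b → not b ⇒ᵇ not a
not-antitone {true} {true}  f ()
not-antitone {true} {false} f _ = f refl
not-antitone {false}        f _ = refl

not-reflects : ∀ {a b} → not b ⇒ᵇ not a → a ⇒ᵇ b
not-reflects {b = true}  f p = refl
not-reflects {b = false} f refl = f refl

anyFin-mono : ∀ n {p p' : Fin n → Bool} → (∀ i → p i ⇒ᵇ p' i) → anyFin n p ⇒ᵇ anyFin n p'
anyFin-mono zero    h ()
anyFin-mono (suc n) h = ∨-mono (h Fin.zero) (anyFin-mono n (h ∘ Fin.suc))

allFin-mono : ∀ n {p p' : Fin n → Bool} → (∀ i → p i ⇒ᵇ p' i) → allFin n p ⇒ᵇ allFin n p'
allFin-mono zero    h _ = refl
allFin-mono (suc n) h = ∧-mono (h Fin.zero) (allFin-mono n (h ∘ Fin.suc))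

anyFin⁻ : ∀ n {p : Fin n → Bool} → anyFin n p ≡ true → ∃[ i ] (p i ≡ true)
anyFin⁻ (suc n) e with ∨-true⁻ e
... | inj₁ p0 = Fin.zero , p0
... | inj₂ ps = let (i , pi) = anyFin⁻ n ps in Fin.suc i , pi

allFin⁻ : ∀ n {p : Fin n → Bool} → allFin n p ≡ true → ∀ i → p i ≡ true
allFin⁻ (suc n) e Fin.zero    = proj₁ (∧-true⁻ e)
allFin⁻ (suc n) e (Fin.suc i) = allFin⁻ n (proj₂ (∧-true⁻ e)) i

Increasing : (ℕ → Bool) → Set
Increasing b = ∀ {i j} → i ≤ j → b i ⇒ᵇ b j

increasing-true-false⇒< : ∀ {b i j} → Increasing b → b i ≡ true → b j ≡ false → j < i
increasing-true-false⇒< inc bi bj = ≰⇒> (λ i≤j → true≢false (inc i≤j bi) bj)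

rising-edge : (b : ℕ → Bool) → b 0 ≡ false → ∀ {n} → b n ≡ true →
  ∃[ m ] (m < n × b m ≡ false × b (suc m) ≡ true)
rising-edge b b0 {zero}  bn = ⊥-elim (true≢false bn b0)
rising-edge b b0 {suc n} bn with b n in bn'
... | false = n , ≤-refl , bn' , bn
... | true  = let (m , m<n , bm , bsm) = rising-edge b b0 bn' in m , m<n⇒m<1+n m<n , bm , bsm

rising-edge-unique : ∀ {b m m'} → Increasing b →
  b m ≡ false → b (suc m) ≡ true → b m' ≡ false → b (suc m') ≡ true → m ≡ m'
rising-edge-unique inc bm bsm bm' bsm' =
  ≤-antisym (s≤s⁻¹ (increasing-true-false⇒< inc bsm' bm))
            (s≤s⁻¹ (increasing-true-false⇒< inc bsm bm'))

Chain : ∀ {A : Set} → (A → A → Set) → (ℕ → A) → Set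
Chain R π = ∀ k → R (π k) (π (suc k))

splice : ∀ {A : Set} → ℕ → (ℕ → A) → (ℕ → A) → ℕ → A
splice zero    π ρ         = ρ
splice (suc n) π ρ zero    = π zero
splice (suc n) π ρ (suc k) = splice n (π ∘ suc) ρ k

module _ {A : Set} where

  splice-head : ∀ n (π ρ : ℕ → A) → ρ 0 ≡ π n → splice n π ρ 0 ≡ π 0
  splice-head zero    π ρ e = e
  splice-head (suc n) π ρ e = refl

  splice-early : ∀ {n} (π ρ : ℕ → A) {i} → i < n → splice n π ρ i ≡ π i
  splice-early {suc n} π ρ {zero}  _         = refl
  splice-early {suc n} π ρ {suc i} (s≤s i<n) = splice-early (π ∘ suc) ρ i<n

  splice-late : ∀ n (π ρ : ℕ → A) k → splice n π ρ (n + k) ≡ ρ k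
  splice-late zero    π ρ k = refl
  splice-late (suc n) π ρ k = splice-late n (π ∘ suc) ρ k

  splice-chain : (R : A → A → Set) → ∀ n {π ρ : ℕ → A} → ρ 0 ≡ π n →
    Chain R π → Chain R ρ → Chain R (splice n π ρ)
  splice-chain R zero    e πR ρR = ρR
  splice-chain R (suc n) {π} {ρ} e πR ρR zero =
    subst (R (π 0)) (sym (splice-head n (π ∘ suc) ρ e)) (πR 0)
  splice-chain R (suc n) e πR ρR (suc k) = splice-chain R n e (πR ∘ suc) ρR k

module Powerset (H : GameGraph) where
  open GameGraph H

  infix 4 _⊆ˢ_

  _⊆ˢ_ : Sub H → Sub H → Set
  P ⊆ˢ P' = ∀ q → P q ⇒ᵇ P' q

  ⊆ˢ-refl : ∀ {P} → P ⊆ˢ P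
  ⊆ˢ-refl _ = id

  ⊆ˢ-trans : ∀ {P P' P''} → P ⊆ˢ P' → P' ⊆ˢ P'' → P ⊆ˢ P''
  ⊆ˢ-trans s t q = t q ∘ s q

  ∅ˢ-⊆ˢ : ∀ {P} → ∅ˢ H ⊆ˢ P
  ∅ˢ-⊆ˢ _ ()

  ∪ˢ-mono : ∀ {P P' R R'} → P ⊆ˢ P' → R ⊆ˢ R' → _∪ˢ_ H P R ⊆ˢ _∪ˢ_ H P' R'
  ∪ˢ-mono s t q = ∨-mono (s q) (t q)

  ∪ˢ-lub : ∀ {P R S} → P ⊆ˢ S → R ⊆ˢ S → _∪ˢ_ H P R ⊆ˢ S
  ∪ˢ-lub s t q p = [ s q , t q ]′ (∨-true⁻ p)

  ∩ˢ-mono : ∀ {P P' R R'} → P ⊆ˢ P' → R ⊆ˢ R' → _∩ˢ_ H P R ⊆ˢ _∩ˢ_ H P' R'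
  ∩ˢ-mono s t q = ∧-mono (s q) (t q)

  ∩ˢ-⊆ˢˡ : ∀ {P R} → _∩ˢ_ H P R ⊆ˢ P
  ∩ˢ-⊆ˢˡ q = proj₁ ∘ ∧-true⁻

  ∁ˢ-antitone : ∀ {P P'} → P ⊆ˢ P' → ∁ˢ H P' ⊆ˢ ∁ˢ H P
  ∁ˢ-antitone s q = not-antitone (s q)

  ∁ˢ-reflects : ∀ {P P'} → ∁ˢ H P' ⊆ˢ ∁ˢ H P → P ⊆ˢ P'
  ∁ˢ-reflects s q = not-reflects (s q)

  Pre∃-mono : ∀ {P P'} → P ⊆ˢ P' → Pre∃ H P ⊆ˢ Pre∃ H P'
  Pre∃-mono s (inj₁ a) = anyFin-mono n1 (λ b → ∧-mono id (s (inj₂ b)))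
  Pre∃-mono s (inj₂ a) = anyFin-mono n0 (λ b → ∧-mono id (s (inj₁ b)))

  Pre1-mono : ∀ {P P'} → P ⊆ˢ P' → Pre1 H P ⊆ˢ Pre1 H P'
  Pre1-mono s (inj₁ a) = allFin-mono n1 (λ b → ∨-mono id (s (inj₂ b)))
  Pre1-mono s (inj₂ a) = anyFin-mono n0 (λ b → ∧-mono id (s (inj₁ b)))

  CPre-mono : ∀ {P P' R R'} → P ⊆ˢ P' → R ⊆ˢ R' → CPre H P R ⊆ˢ CPre H P' R'
  CPre-mono s t = ∩ˢ-mono (Pre∃-mono s) (Pre1-mono (∪ˢ-mono s t))

  Pre∃⇒successor : ∀ {P q} → Pre∃ H P q ≡ true → ∃[ q' ] (Edge H q q' ≡ true × P q' ≡ true)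
  Pre∃⇒successor {q = inj₁ a} p = let (b , e) = anyFin⁻ n1 p in inj₂ b , ∧-true⁻ e
  Pre∃⇒successor {q = inj₂ a} p = let (b , e) = anyFin⁻ n0 p in inj₁ b , ∧-true⁻ e

  Pre∃-∅ˢ : ∀ {q} → Pre∃ H (∅ˢ H) q ≡ true → ⊥
  Pre∃-∅ˢ {q} p with Pre∃⇒successor {∅ˢ H} {q} p
  ... | _ , _ , ()

  Pre1-env : ∀ {P x q'} → Pre1 H P (inj₁ x) ≡ true → Edge H (inj₁ x) q' ≡ true → P q' ≡ true
  Pre1-env {P} {q' = inj₂ b} p e = subst (λ d → not d ∨ P (inj₂ b) ≡ true) e (allFin⁻ n1 p b)

  encode : Sub H → Subset (card H)
  encode P = tabulate (P ∘ splitAt n0)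

  ∣_∣ˢ : Sub H → ℕ
  ∣ P ∣ˢ = ∣ encode P ∣

  ∈-encode⁺ : ∀ {P x} → P (splitAt n0 x) ≡ true → x ∈ encode P
  ∈-encode⁺ {P} {x} p = lookup⇒[]= x (encode P) (trans (lookup∘tabulate _ x) p)

  ∈-encode⁻ : ∀ {P x} → x ∈ encode P → P (splitAt n0 x) ≡ true
  ∈-encode⁻ {P} {x} m = trans (sym (lookup∘tabulate _ x)) ([]=⇒lookup m)

  ⊂ˢ⇒∣∣ˢ< : ∀ {P P' q} → P ⊆ˢ P' → P' q ≡ true → P q ≡ false → ∣ P ∣ˢ < ∣ P' ∣ˢ
  ⊂ˢ⇒∣∣ˢ< {P} {P'} {q} s p' p = p⊂q⇒∣p∣<∣q∣
    ( (λ m → ∈-encode⁺ {P'} (s _ (∈-encode⁻ {P} m)))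
    , join n0 n1 q
    , ∈-encode⁺ {P'} (subst (λ r → P' r ≡ true) (sym (splitAt-join n0 n1 q)) p')
    , λ m → true≢false (subst (λ r → P r ≡ true) (splitAt-join n0 n1 q) (∈-encode⁻ {P} m)) p )

  ⊆ˢ-by-size : ∀ {P P'} → P ⊆ˢ P' → ∣ P' ∣ˢ ≤ ∣ P ∣ˢ → P' ⊆ˢ P
  ⊆ˢ-by-size {P} s le q p' with P q in p
  ... | true  = refl
  ... | false = ⊥-elim (<⇒≱ (⊂ˢ⇒∣∣ˢ< s p' p) le)

  -- Each step of a non-stationary chain adds a state, which can happen at most |Q| times.
  ascending-stabilises : (S : ℕ → Sub H) → (∀ k → S k ⊆ˢ S (suc k)) →
    (∀ k → S (suc k) ⊆ˢ S k → S (suc (suc k)) ⊆ˢ S (suc k)) →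
    S (suc (card H)) ⊆ˢ S (card H)
  ascending-stabilises S up stays = [ id , too-long ]′ (grown (card H))
    where
    step : ∀ k → S (suc k) ⊆ˢ S k ⊎ ∣ S k ∣ˢ < ∣ S (suc k) ∣ˢ
    step k with ∣ S (suc k) ∣ˢ ≤? ∣ S k ∣ˢ
    ... | yes le = inj₁ (⊆ˢ-by-size (up k) le)
    ... | no  gt = inj₂ (≰⇒> gt)
    grown : ∀ k → S (suc k) ⊆ˢ S k ⊎ suc k ≤ ∣ S (suc k) ∣ˢ
    grown zero = map₂ (≤-<-trans z≤n) (step zero)
    grown (suc k) with grown k
    ... | inj₁ st  = inj₁ (stays k st)
    ... | inj₂ big = map₂ (≤-<-trans big) (step (suc k))
    too-long : suc (card H) ≤ ∣ S (suc (card H)) ∣ˢ → S (suc (card H)) ⊆ˢ S (card H)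
    too-long big = ⊥-elim (<-irrefl refl (≤-trans big (∣p∣≤n (encode (S (suc (card H)))))))

  descending-stabilises : (S : ℕ → Sub H) → (∀ k → S (suc k) ⊆ˢ S k) →
    (∀ k → S k ⊆ˢ S (suc k) → S (suc k) ⊆ˢ S (suc (suc k))) →
    S (card H) ⊆ˢ S (suc (card H))
  descending-stabilises S down stays = ∁ˢ-reflects (ascending-stabilises (∁ˢ H ∘ S)
    (∁ˢ-antitone ∘ down) (λ k → ∁ˢ-antitone ∘ stays k ∘ ∁ˢ-reflects))

  ascending-≤ : (S : ℕ → Sub H) → (∀ k → S k ⊆ˢ S (suc k)) → ∀ {i j} → i ≤ j → S i ⊆ˢ S j
  ascending-≤ S up = go ∘ ≤⇒≤′
    where
    go : ∀ {i j} → i ≤′ j → S i ⊆ˢ S j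
    go ≤′-refl        = ⊆ˢ-refl
    go (≤′-step i≤′j) = ⊆ˢ-trans (go i≤′j) (up _)

  Monotone : (Sub H → Sub H) → Set
  Monotone f = ∀ {P P'} → P ⊆ˢ P' → f P ⊆ˢ f P'

  module _ {f g : Sub H → Sub H} (f≤g : ∀ {P P'} → P ⊆ˢ P' → f P ⊆ˢ g P') where

    iter-mono : ∀ k {P P'} → P ⊆ˢ P' → iter H k f P ⊆ˢ iter H k g P'
    iter-mono zero    s = s
    iter-mono (suc k) s = f≤g (iter-mono k s)

    μ-mono : μ H f ⊆ˢ μ H g
    μ-mono = iter-mono (card H) ⊆ˢ-refl

    ν-mono : ν H f ⊆ˢ ν H g
    ν-mono = iter-mono (card H) ⊆ˢ-refl

  module _ {f : Sub H → Sub H} (mono : Monotone f) where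

    iter-ascending : ∀ k → iter H k f (∅ˢ H) ⊆ˢ iter H (suc k) f (∅ˢ H)
    iter-ascending zero    = ∅ˢ-⊆ˢ
    iter-ascending (suc k) = mono (iter-ascending k)

    iter-descending : ∀ k → iter H (suc k) f (Qˢ H) ⊆ˢ iter H k f (Qˢ H)
    iter-descending zero    _ _ = refl
    iter-descending (suc k) = mono (iter-descending k)

    μ-fold : f (μ H f) ⊆ˢ μ H f
    μ-fold = ascending-stabilises (λ k → iter H k f (∅ˢ H)) iter-ascending (λ _ → mono)

    iter-⊆ˢ-μ : ∀ k → iter H k f (∅ˢ H) ⊆ˢ μ H f
    iter-⊆ˢ-μ zero    = ∅ˢ-⊆ˢ
    iter-⊆ˢ-μ (suc k) = ⊆ˢ-trans (mono (iter-⊆ˢ-μ k)) μ-fold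

    ν-fold : f (ν H f) ⊆ˢ ν H f
    ν-fold = iter-descending (card H)

    ν-unfold : ν H f ⊆ˢ f (ν H f)
    ν-unfold = descending-stabilises (λ k → iter H k f (Qˢ H)) iter-descending (λ _ → mono)

module Ranking (H : GameGraph) (FA FG : Sub H) where
  open Powerset H
  open Fix H FA FG

  body-mono : ∀ {Z Z' Y Y' X X' W W'} → Z ⊆ˢ Z' → Y ⊆ˢ Y' → X ⊆ˢ X' → W ⊆ˢ W' →
    body Z Y X W ⊆ˢ body Z' Y' X' W'
  body-mono z y x w =
    ∪ˢ-mono (∪ˢ-mono (∩ˢ-mono (⊆ˢ-refl {FG}) (Pre1-mono z)) (Pre1-mono y))
            (∩ˢ-mono (⊆ˢ-refl {∁ˢ H FA}) (CPre-mono w (∩ˢ-mono x (⊆ˢ-refl {∁ˢ H FA}))))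

  -- Up to unfolding, Zinf = ν μY and Yit (suc i) = νX Zinf (Yit i).
  μW : Sub H → Sub H → Sub H → Sub H
  μW Z Y X = μ H (body Z Y X)

  νX : Sub H → Sub H → Sub H
  νX Z Y = ν H (μW Z Y)

  μY : Sub H → Sub H
  μY Z = μ H (νX Z)

  μW-mono : ∀ {Z Z' Y Y' X X'} → Z ⊆ˢ Z' → Y ⊆ˢ Y' → X ⊆ˢ X' → μW Z Y X ⊆ˢ μW Z' Y' X'
  μW-mono z y x = μ-mono (body-mono z y x)

  νX-mono : ∀ {Z Z' Y Y'} → Z ⊆ˢ Z' → Y ⊆ˢ Y' → νX Z Y ⊆ˢ νX Z' Y'
  νX-mono z y = ν-mono (μW-mono z y)

  μY-mono : Monotone μY
  μY-mono z = μ-mono (νX-mono z)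

  Φ-mono : ∀ {Y X} → Monotone (Φ Y X)
  Φ-mono = body-mono ⊆ˢ-refl ⊆ˢ-refl ⊆ˢ-refl

  Yit≡iter : ∀ i → Yit i ≡ iter H i (νX Zinf) (∅ˢ H)
  Yit≡iter zero    = refl
  Yit≡iter (suc i) = cong (νX Zinf) (Yit≡iter i)

  Wit≡iter : ∀ a j → Wit (suc a) j ≡ iter H j (Φ (Yit a) (Yit (suc a))) (∅ˢ H)
  Wit≡iter a zero    = refl
  Wit≡iter a (suc j) = cong (Φ (Yit a) (Yit (suc a))) (Wit≡iter a j)

  Yit-⊆ˢ-Zinf : ∀ i → Yit i ⊆ˢ Zinf
  Yit-⊆ˢ-Zinf i rewrite Yit≡iter i = ⊆ˢ-trans (iter-⊆ˢ-μ (νX-mono ⊆ˢ-refl) i) (ν-fold μY-mono)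

  Zinf-⊆ˢ-Yit : Zinf ⊆ˢ Yit (card H)
  Zinf-⊆ˢ-Yit rewrite Yit≡iter (card H) = ν-unfold μY-mono

  Wit-⊆ˢ-Yit : ∀ a j → Wit (suc a) j ⊆ˢ Yit (suc a)
  Wit-⊆ˢ-Yit a j rewrite Wit≡iter a j =
    ⊆ˢ-trans (iter-⊆ˢ-μ Φ-mono j) (ν-fold (μW-mono ⊆ˢ-refl ⊆ˢ-refl))

  Yit-⊆ˢ-Wit : ∀ a → Yit (suc a) ⊆ˢ Wit (suc a) (card H)
  Yit-⊆ˢ-Wit a rewrite Wit≡iter a (card H) = ν-unfold (μW-mono ⊆ˢ-refl ⊆ˢ-refl)

  Yit-ascending : ∀ i → Yit i ⊆ˢ Yit (suc i)
  Yit-ascending zero    = ∅ˢ-⊆ˢ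
  Yit-ascending (suc i) = νX-mono ⊆ˢ-refl (Yit-ascending i)

  Wit-ascending : ∀ a j → Wit (suc a) j ⊆ˢ Wit (suc a) (suc j)
  Wit-ascending a zero    = ∅ˢ-⊆ˢ
  Wit-ascending a (suc j) = Φ-mono (Wit-ascending a j)

  Yit-mono : ∀ {i j} → i ≤ j → Yit i ⊆ˢ Yit j
  Yit-mono = ascending-≤ Yit Yit-ascending

  Wit-mono : ∀ a {i j} → i ≤ j → Wit (suc a) i ⊆ˢ Wit (suc a) j
  Wit-mono a = ascending-≤ (Wit (suc a)) (Wit-ascending a)

  rank-below : ∀ {q i} → Zinf q ≡ true → Yit i q ≡ true →
    ∃[ a ] ∃[ c ] (a < i × Rank q (suc a) (suc c))
  rank-below {q} z y with rising-edge (λ k → Yit k q) refl y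
  ... | a , a<i , ya , ysa
    with rising-edge (λ k → Wit (suc a) k q) refl {card H} (Yit-⊆ˢ-Wit a q ysa)
  ... | c , _ , wc , wsc = a , c , a<i , z , ysa , ya , wsc , wc

  rank-exists : ∀ {q} → Zinf q ≡ true → ∃[ a ] ∃[ c ] Rank q (suc a) (suc c)
  rank-exists z = let (a , c , _ , r) = rank-below {i = card H} z (Zinf-⊆ˢ-Yit _ z) in a , c , r

  rank-unique : ∀ {q a c a' c'} → Rank q (suc a) (suc c) → Rank q (suc a') (suc c') →
    a ≡ a' × c ≡ c'
  rank-unique {q} {a} {a' = a'} (_ , ysa , ya , wsc , wc) (_ , ysa' , ya' , wsc' , wc')
    with rising-edge-unique {m = a} {m' = a'} (λ le → Yit-mono le q) ya ysa ya' ysa'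
  ... | refl = refl , rising-edge-unique (λ le → Wit-mono a le q) wc wsc wc' wsc'

  Rank⇒Yit : ∀ {q i j} → Rank q i j → Yit i q ≡ true
  Rank⇒Yit {i = suc _} {j = suc _} (_ , y , _) = y

  -- The three disjuncts of φ₄, with the CPre-successors weakened from W ∪ (X ∖ F_A) to Y^{a+1}.
  data Wit-Case (a c : ℕ) (q : State H) : Set where
    accept   : FG q ≡ true → Pre1 H Zinf q ≡ true → Wit-Case a c q
    descend  : Pre1 H (Yit a) q ≡ true → Wit-Case a c q
    progress : FA q ≡ false → Pre∃ H (Wit (suc a) c) q ≡ true → Pre1 H (Yit (suc a)) q ≡ true →
               Wit-Case a c q

  Wit-cases : ∀ a c {q} → Wit (suc a) (suc c) q ≡ true → Wit-Case a c q
  Wit-cases a c p with ∨-true⁻ p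
  ... | inj₁ p' with ∨-true⁻ p'
  ...   | inj₁ g = let (fg , pre) = ∧-true⁻ g in accept fg pre
  ...   | inj₂ d = descend d
  Wit-cases a c {q} p | inj₂ s =
    let (nfa , cpre) = ∧-true⁻ s
        (pre∃ , pre1) = ∧-true⁻ cpre
    in progress (not-true⁻ nfa) pre∃
         (Pre1-mono (∪ˢ-lub (Wit-⊆ˢ-Yit a c) (∩ˢ-⊆ˢˡ {Yit (suc a)} {∁ˢ H FA})) q pre1)

  Zinf-⊆ˢ-Pre1 : Zinf ⊆ˢ Pre1 H Zinf
  Zinf-⊆ˢ-Pre1 q z with rank-exists z
  ... | a , c , (_ , _ , _ , w , _) with Wit-cases a c w
  ... | accept _ p     = p
  ... | descend p      = Pre1-mono (Yit-⊆ˢ-Zinf a) q p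
  ... | progress _ _ p = Pre1-mono (Yit-⊆ˢ-Zinf (suc a)) q p

  -- A system state of rank (1,1) has no successor in Y⁰ = W¹₀ = ∅, so it must be in F_G.
  sys-rank₁₁⇒FG : ∀ {s} → Rank (inj₂ s) 1 1 → FG (inj₂ s) ≡ true
  sys-rank₁₁⇒FG {s} (_ , _ , _ , w , _) with Wit-cases 0 0 w
  ... | accept fg _    = fg
  ... | descend p      = ⊥-elim (Pre∃-∅ˢ {inj₂ s} p)
  ... | progress _ p _ = ⊥-elim (Pre∃-∅ˢ {inj₂ s} p)

  descend⇒Wit₁ : ∀ {a q} → Pre1 H (Yit a) q ≡ true → Wit (suc a) 1 q ≡ true
  descend⇒Wit₁ {q = q} p = ∨-trueˡ _ (∨-trueʳ (FG q ∧ Pre1 H Zinf q) p)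

  RankedBelow : State H → ℕ × ℕ → Set
  RankedBelow q r = ∃[ i ] ∃[ j ] (Rank q i j × (i , j) <lex r)

  Descends : State H → State H → Set
  Descends q q' = ∀ {i j} → Rank q i j → RankedBelow q' (i , j)

  descends-from : ∀ {q q' a c} → Rank q (suc a) (suc c) → RankedBelow q' (suc a , suc c) →
    Descends q q'
  descends-from r below {zero} ()
  descends-from r below {suc _} {zero} ()
  descends-from {a = a} {c} r below {suc i} {suc j} r' with rank-unique {a = a} {c} {i} {j} r r'
  ... | refl , refl = below

  Yit⇒RankedBelow : ∀ {q a j} → Yit a q ≡ true → RankedBelow q (suc a , j)
  Yit⇒RankedBelow {q} {a} y =
    let (a' , c' , a'<a , r) = rank-below (Yit-⊆ˢ-Zinf a q y) y
    in suc a' , suc c' , r , inj₁ (s≤s a'<a)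

  Wit⇒RankedBelow : ∀ {q a c} → Wit (suc a) c q ≡ true → RankedBelow q (suc a , suc c)
  Wit⇒RankedBelow {q} {a} {c} w = lower (rank-below (Yit-⊆ˢ-Zinf (suc a) q y) y)
    where
    y = Wit-⊆ˢ-Yit a c q w
    lower : ∃[ a' ] ∃[ c' ] (a' < suc a × Rank q (suc a') (suc c')) → RankedBelow q (suc a , suc c)
    lower (a' , c' , a'<sa , r@(_ , _ , _ , _ , wc')) with m<1+n⇒m<n∨m≡n a'<sa
    ... | inj₁ a'<a = suc a' , suc c' , r , inj₁ (s≤s a'<a)
    ... | inj₂ refl = suc a' , suc c' , r ,
                      inj₂ (refl , s≤s (increasing-true-false⇒< (λ le → Wit-mono a le q) w wc'))

  RankedBelow⇒Yit : ∀ {q i j} → RankedBelow q (i , j) → Yit i q ≡ true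
  RankedBelow⇒Yit {q} (i' , _ , r , lt) = Yit-mono (lex-fst lt) q (Rank⇒Yit r)
    where
    lex-fst : ∀ {i' j' i j} → (i' , j') <lex (i , j) → i' ≤ i
    lex-fst (inj₁ i'<i)       = <⇒≤ i'<i
    lex-fst (inj₂ (refl , _)) = ≤-refl

  RankedBelow-column₁⇒Yit : ∀ {q a} → RankedBelow q (suc a , 1) → Yit a q ≡ true
  RankedBelow-column₁⇒Yit {q} (_ , _ , r , inj₁ i'<sa) = Yit-mono (s≤s⁻¹ i'<sa) q (Rank⇒Yit r)
  RankedBelow-column₁⇒Yit (suc _ , zero  , () , inj₂ _)
  RankedBelow-column₁⇒Yit (_     , suc _ , _  , inj₂ (_ , s≤s ()))

  RankReducing : MemorylessStrategy H → Set
  RankReducing f1 = (s : Fin (GameGraph.n1 H)) → Zinf (inj₂ s) ≡ true →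
    (GameGraph.δ1 H s (f1 s) ≡ true) × (Zinf (inj₁ (f1 s)) ≡ true) ×
    ((i j : ℕ) → Rank (inj₂ s) i j → (1 , 1) <lex (i , j) → RankedBelow (inj₁ (f1 s)) (i , j))

<lex-wellFounded : WellFounded _<lex_
<lex-wellFounded = ×-wellFounded <-wellFounded <-wellFounded

module Strategy (H : GameGraph) (FA FG : Sub H) (f1 : MemorylessStrategy H)
                (f1-reduces : Ranking.RankReducing H FA FG f1) where
  open GameGraph H
  open Powerset H
  open Fix H FA FG
  open Ranking H FA FG

  Step : State H → State H → Set
  Step q q' = Edge H q q' ≡ true × (∀ s → q ≡ inj₂ s → q' ≡ inj₁ (f1 s))

  Lstrat⇒Chain : ∀ {q π} → Lstrat H q f1 π → Chain Step π
  Lstrat⇒Chain ((_ , edges) , compliant) k = edges k , compliant k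

  Chain⇒Lstrat : ∀ {q π} → π 0 ≡ q → Chain Step π → Lstrat H q f1 π
  Chain⇒Lstrat start steps = (start , proj₁ ∘ steps) , proj₂ ∘ steps

  Zinf-step : ∀ {q q'} → Zinf q ≡ true → Step q q' → Zinf q' ≡ true
  Zinf-step {inj₁ x} z (e , _) = Pre1-env {Zinf} (Zinf-⊆ˢ-Pre1 _ z) e
  Zinf-step {inj₂ s} z (_ , compliant) rewrite compliant s refl = proj₁ (proj₂ (f1-reduces s z))

  Zinf-along : ∀ {q π} → Lstrat H q f1 π → Zinf q ≡ true → ∀ k → Zinf (π k) ≡ true
  Zinf-along ((start , _) , _) z zero rewrite start = z
  Zinf-along L z (suc k) = Zinf-step (Zinf-along L z k) (Lstrat⇒Chain L k)

  sys-descends : ∀ {s} → FG (inj₂ s) ≡ false → Descends (inj₂ s) (inj₁ (f1 s))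
  sys-descends fg {zero} ()
  sys-descends fg {suc _} {zero} ()
  sys-descends fg {1} {1} r = ⊥-elim (true≢false (sys-rank₁₁⇒FG r) fg)
  sys-descends {s} fg {1} {suc (suc c)} r =
    proj₂ (proj₂ (f1-reduces s (proj₁ r))) _ _ r (inj₂ (refl , s≤s (s≤s z≤n)))
  sys-descends {s} fg {suc (suc a)} {suc c} r =
    proj₂ (proj₂ (f1-reduces s (proj₁ r))) _ _ r (inj₁ (s≤s (s≤s z≤n)))

  -- A system state in F_A ∖ F_G can only be in W^{a+1} through Pre¹(Y^a), so it lies in W^{a+1}₁.
  sys-FA-column₁ : ∀ {s a c} → Rank (inj₂ s) (suc a) (suc c) → FG (inj₂ s) ≡ false →
    FA (inj₂ s) ≡ true → c ≡ 0
  sys-FA-column₁ {a = a} {c} (_ , _ , _ , w , wc) fg fa with Wit-cases a c w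
  ... | accept g _       = ⊥-elim (true≢false g fg)
  ... | progress fa' _ _ = ⊥-elim (true≢false fa fa')
  ... | descend p        =
    n<1⇒n≡0 (increasing-true-false⇒< (λ le → Wit-mono a le _) (descend⇒Wit₁ {a} p) wc)

  ranked-step : ∀ {q q' a c} → Rank q (suc a) (suc c) → FG q ≡ false → Step q q' →
    Yit (suc a) q' ≡ true × (FA q ≡ true → Yit a q' ≡ true)
  ranked-step {inj₁ x} {a = a} {c} (_ , _ , _ , w , _) fg (e , _) with Wit-cases a c w
  ... | accept g _      = ⊥-elim (true≢false g fg)
  ... | descend p       = let y = Pre1-env {Yit a} p e in Yit-ascending a _ y , λ _ → y
  ... | progress fa _ p = Pre1-env {Yit (suc a)} p e , λ fa' → ⊥-elim (true≢false fa' fa)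
  ranked-step {inj₂ s} {a = a} {c} r fg (_ , compliant) rewrite compliant s refl =
    RankedBelow⇒Yit below , λ fa →
      RankedBelow-column₁⇒Yit (subst (λ c → RankedBelow (inj₁ (f1 s)) (suc a , suc c))
                                        (sys-FA-column₁ {a = a} {c} r fg fa) below)
    where
    below : RankedBelow (inj₁ (f1 s)) (suc a , suc c)
    below = sys-descends fg {suc a} {suc c} r

  Yit-step : ∀ {q q'} i → Zinf q ≡ true → Yit (suc i) q ≡ true → FG q ≡ false → Step q q' →
    Yit (suc i) q' ≡ true × (FA q ≡ true → Yit i q' ≡ true)
  Yit-step {q' = q'} i z y fg st =
    let (a , c , a<si , r) = rank-below {i = suc i} z y
        (y' , drop) = ranked-step {a = a} {c} r fg st
        a≤i = s≤s⁻¹ a<si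
    in Yit-mono (s≤s a≤i) q' y' , Yit-mono a≤i q' ∘ drop

  module _ {q π} (L : Lstrat H q f1 π) (zq : Zinf q ≡ true) where

    FG-after : ℕ → Set
    FG-after k = ∃[ m ] (k ≤ m × FG (π m) ≡ true)

    Yit-step-along : ∀ i k → Yit (suc i) (π k) ≡ true → FG (π k) ≡ false →
      Yit (suc i) (π (suc k)) ≡ true × (FA (π k) ≡ true → Yit i (π (suc k)) ≡ true)
    Yit-step-along i k y fg = Yit-step i (Zinf-along L zq k) y fg (Lstrat⇒Chain L k)

    stays-in-Yit : ∀ i {k m} → Yit (suc i) (π k) ≡ true → k ≤′ m →
      FG-after k ⊎ Yit (suc i) (π m) ≡ true
    stays-in-Yit i y ≤′-refl = inj₂ y
    stays-in-Yit i {m = suc m} y (≤′-step k≤′m) with stays-in-Yit i y k≤′m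
    ... | inj₁ found = inj₁ found
    ... | inj₂ ym with FG (π m) in g
    ...   | true  = inj₁ (m , ≤′⇒≤ k≤′m , g)
    ...   | false = inj₂ (proj₁ (Yit-step-along i m ym g))

    FG-after-Yit : InfOften H FA π → ∀ i k → Yit i (π k) ≡ true → FG-after k
    FG-after-Yit FA-often (suc i) k y with FA-often k
    ... | m , k≤m , fa with stays-in-Yit i y (≤⇒≤′ k≤m)
    ...   | inj₁ found = found
    ...   | inj₂ ym with FG (π m) in g
    ...     | true  = m , k≤m , g
    ...     | false =
      let (m' , m<m' , g') = FG-after-Yit FA-often i (suc m) (proj₂ (Yit-step-along i m ym g) fa)
      in m' , ≤-trans k≤m (<⇒≤ m<m') , g'

    FA-often⇒FG-often : InfOften H FA π → InfOften H FG π
    FA-often⇒FG-often FA-often k =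
      FG-after-Yit FA-often (card H) k (Zinf-⊆ˢ-Yit _ (Zinf-along L zq k))

  module _ (nb : NonBlocking H) where

    env-descent : ∀ {x a c} → Rank (inj₁ x) (suc a) (suc c) → FG (inj₁ x) ≡ false →
      ∃[ q' ] (Edge H (inj₁ x) q' ≡ true × RankedBelow q' (suc a , suc c))
    env-descent {x} {a} {c} (_ , _ , _ , w , _) fg with Wit-cases a c w
    ... | accept g _ = ⊥-elim (true≢false g fg)
    ... | descend p =
      let (q' , e) = nb (inj₁ x) in q' , e , Yit⇒RankedBelow (Pre1-env {Yit a} p e)
    ... | progress _ p _ =
      let (q' , e , w') = Pre∃⇒successor {Wit (suc a) c} {inj₁ x} p in q' , e , Wit⇒RankedBelow w'

    env-choice : (x : Fin n0) → ∃[ q' ] (Edge H (inj₁ x) q' ≡ true ×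
      (Zinf (inj₁ x) ≡ true → FG (inj₁ x) ≡ false → Descends (inj₁ x) q'))
    env-choice x with Zinf (inj₁ x) in z | FG (inj₁ x) in g
    ... | true  | false =
      let (a , c , r) = rank-exists z
          (q' , e , below) = env-descent {a = a} {c} r g
      in q' , e , λ _ _ → descends-from {a = a} {c} r below
    ... | true  | true  = let (q' , e) = nb (inj₁ x) in q' , e , λ _ ()
    ... | false | _     = let (q' , e) = nb (inj₁ x) in q' , e , λ ()

    next : State H → State H
    next (inj₁ x) = proj₁ (env-choice x)
    next (inj₂ s) = inj₁ (f1 s)

    next-step : ∀ {q} → Zinf q ≡ true → Step q (next q)
    next-step {inj₁ x} _ = proj₁ (proj₂ (env-choice x)) , λ _ ()
    next-step {inj₂ s} z = proj₁ (f1-reduces s z) , λ { _ refl → refl }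

    next-descends : ∀ {q} → Zinf q ≡ true → FG q ≡ false → Descends q (next q)
    next-descends {inj₁ x} = proj₂ (proj₂ (env-choice x))
    next-descends {inj₂ s} _ = sys-descends

    Zinf-next : ∀ {q} → Zinf q ≡ true → Zinf (next q) ≡ true
    Zinf-next z = Zinf-step z (next-step z)

    run : State H → ℕ → State H
    run q zero    = q
    run q (suc k) = run (next q) k

    run-Chain : ∀ {q} → Zinf q ≡ true → Chain Step (run q)
    run-Chain z zero    = next-step z
    run-Chain z (suc k) = run-Chain (Zinf-next z) k

    run-Zinf : ∀ {q} → Zinf q ≡ true → ∀ k → Zinf (run q k) ≡ true
    run-Zinf z zero    = z
    run-Zinf z (suc k) = run-Zinf (Zinf-next z) k

    run-+ : ∀ q k m → run q (k + m) ≡ run (run q k) m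
    run-+ q zero    m = refl
    run-+ q (suc k) m = run-+ (next q) k m

    reaches-FG : ∀ {q i j} → Zinf q ≡ true → Rank q i j → Acc _<lex_ (i , j) →
      ∃[ m ] (FG (run q m) ≡ true)
    reaches-FG {q} z r (acc smaller) with FG q in g
    ... | true  = 0 , g
    ... | false =
      let (_ , _ , r' , lt) = next-descends z g r
          (m , g') = reaches-FG (Zinf-next z) r' (smaller lt)
      in suc m , g'

    run-FG-often : ∀ {q} → Zinf q ≡ true → InfOften H FG (run q)
    run-FG-often {q} z k =
      let zk = run-Zinf z k
          (a , c , r) = rank-exists zk
          (m , g) = reaches-FG {i = suc a} {suc c} zk r (<lex-wellFounded _)
      in k + m , m≤m+n k m , subst (λ p → FG p ≡ true) (sym (run-+ q k m)) g

    compliant-FG-play : ∀ {q} → Zinf q ≡ true → ∃[ π ] (Lstrat H q f1 π × Lbuchi H q FG π)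
    compliant-FG-play {q} z =
      let L = Chain⇒Lstrat refl (run-Chain z) in run q , L , proj₁ L , run-FG-often z

    prefix-extends-to-FA-play : ∀ {q} → Zinf q ≡ true →
      ((π : ℕ → State H) → Lbuchi H q FG π → Lbuchi H q FA π) → ∀ {w} →
      pre H (Lstrat H q f1) w → pre H (λ π → Lstrat H q f1 π × Lbuchi H q FA π) w
    prefix-extends-to-FA-play {q} zq FG⇒FA {w} (π , L , w≼π) =
      π' , (L' , FG⇒FA π' (proj₁ L' , FG-often)) ,
      λ i → trans (w≼π i) (sym (splice-early π ρ (toℕ<n i)))
      where
      n = length w
      zn = Zinf-along L zq n
      ρ = run (π n)
      π' = splice n π ρ
      L' : Lstrat H q f1 π'
      L' = Chain⇒Lstrat (trans (splice-head n π ρ refl) (proj₁ (proj₁ L)))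
                        (splice-chain Step n refl (Lstrat⇒Chain L) (run-Chain zn))
      FG-often : InfOften H FG π'
      FG-often k =
        let (m , k≤m , g) = run-FG-often zn k
        in n + m , ≤-trans k≤m (m≤n+m m n) , subst (λ p → FG p ≡ true) (sym (splice-late n π ρ m)) g

theorem1 : (H : GameGraph) → NonBlocking H → (FA FG : Sub H) →
    (f1 : MemorylessStrategy H) →
    ((s : Fin (GameGraph.n1 H)) → Fix.Zinf H FA FG (inj₂ s) ≡ true →
      (GameGraph.δ1 H s (f1 s) ≡ true) ×
      (Fix.Zinf H FA FG (inj₁ (f1 s)) ≡ true) ×
      ((i j : ℕ) → Fix.Rank H FA FG (inj₂ s) i j → (1 , 1) <lex (i , j) →
        ∃[ i' ] ∃[ j' ] (Fix.Rank H FA FG (inj₁ (f1 s)) i' j' × (i' , j') <lex (i , j)))) →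
    (q : State H) → Fix.Zinf H FA FG q ≡ true →
      ((π : ℕ → State H) → Lstrat H q f1 π → InfOften H FA π → InfOften H FG π)
      ×
      (∃[ π ] (Lstrat H q f1 π × Lbuchi H q FG π))
      ×
      (((π : ℕ → State H) → Lbuchi H q FG π → Lbuchi H q FA π) →
        (w : List (State H)) →
          pre H (Lstrat H q f1) w ⇔ pre H (λ π → Lstrat H q f1 π × Lbuchi H q FA π) w)
theorem1 H nb FA FG f1 f1-reduces q zq =
    (λ π L → FA-often⇒FG-often L zq)
  , compliant-FG-play nb zq
  , λ FG⇒FA w → mk⇔ (prefix-extends-to-FA-play nb zq FG⇒FA {w})
                    (λ (π , (L , _) , w≼π) → π , L , w≼π)
  where open Strategy H FA FG f1 f1-reduces
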